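{- Let \(G=(V,E)\) be a simple, undirected, connected graph and let \(T\) be a spanning tree of \(G\). Let \(\mathcal{A}_T\) be the graph whose vertices correspond one-to-one to the non-tree edges \(e\in E\setminus E(T)\) (the vertex for \(e=ab\) representing the unique path in \(T\) between \(a\) and \(b\)), with two vertices adjacent if and only if their corresponding tree paths share at least one edge. Let \(F\subseteq E\setminus E(T)\). Then \(H=(V,E(T)\cup F)\) is a cactus if and only if the set of vertices of \(\mathcal{A}_T\) corresponding to \(F\) is an independent set in \(\mathcal{A}_T\).
   Context: A cactus is a connected graph in which every edge belongs to at most one (simple) cycle. -}

module Defs where

open import Data.Nat using (ℕ; _≤_)
open import Data.Fin using (Fin)
open import Data.Bool using (Bool; true; false; _∨_)
open import Data.List using (List; []; _∷_; _++_; head; last; length)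
open import Data.Maybe using (just)
open import Data.Product using (Σ; _×_; ∃; ∃-syntax; _,_)
open import Data.Sum using (_⊎_)
open import Data.List.Relation.Unary.Linked using (Linked)
open import Data.List.Relation.Unary.Unique.Propositional using (Unique)
open import Relation.Nullary using (¬_)
open import Relation.Binary.PropositionalEquality using (_≡_)
open import Function.Bundles using (_⇔_)

Rel : ℕ → Set
Rel n = Fin n → Fin n → Bool

module _ {n : ℕ} where

  Adj : Rel n → Fin n → Fin n → Set
  Adj R u v = R u v ≡ true

  Symmetric : Rel n → Set
  Symmetric R = ∀ u v → R u v ≡ R v u

  Irreflexive : Rel n → Set
  Irreflexive R = ∀ u → R u u ≡ false

  SimpleGraph : Rel n → Set
  SimpleGraph R = Symmetric R × Irreflexive R

  _⊆_ : Rel n → Rel n → Set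
  R ⊆ S = ∀ u v → Adj R u v → Adj S u v

  IsPath : Rel n → Fin n → Fin n → List (Fin n) → Set
  IsPath R a b xs = (head xs ≡ just a) × (last xs ≡ just b) × Linked (Adj R) xs × Unique xs

  Connected : Rel n → Set
  Connected R = ∀ a b → ∃[ xs ] IsPath R a b xs

  data EdgeOn (u v : Fin n) : List (Fin n) → Set where
    here  : ∀ {xs} → EdgeOn u v (u ∷ v ∷ xs)
    here' : ∀ {xs} → EdgeOn u v (v ∷ u ∷ xs)
    there : ∀ {x xs} → EdgeOn u v xs → EdgeOn u v (x ∷ xs)

  IsCycle : Rel n → List (Fin n) → Set
  IsCycle R [] = Data.Empty.⊥
    where import Data.Empty
  IsCycle R (x ∷ xs) = (3 ≤ length (x ∷ xs)) × Unique (x ∷ xs) × Linked (Adj R) (x ∷ xs ++ x ∷ [])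

  InCycle : Fin n → Fin n → List (Fin n) → Set
  InCycle u v [] = Data.Empty.⊥
    where import Data.Empty
  InCycle u v (x ∷ xs) = EdgeOn u v (x ∷ xs ++ x ∷ [])

  Acyclic : Rel n → Set
  Acyclic R = ∀ xs → ¬ IsCycle R xs

  Tree : Rel n → Set
  Tree R = Symmetric R × Connected R × Acyclic R

  SpanningTree : Rel n → Rel n → Set
  SpanningTree G T = T ⊆ G × Tree T

  -- cactus: connected, every edge lies in at most one simple cycle
  -- (two cycles are the same iff they have the same edge set)
  Cactus : Rel n → Set
  Cactus R = Connected R ×
    (∀ u v → Adj R u v → ∀ c₁ c₂ → IsCycle R c₁ → IsCycle R c₂ →
       InCycle u v c₁ → InCycle u v c₂ → ∀ a b → InCycle a b c₁ ⇔ InCycle a b c₂)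

  _∪_ : Rel n → Rel n → Rel n
  (R ∪ S) u v = R u v ∨ S u v

  -- non-tree edge of G w.r.t. T (as an ordered representative of the unordered edge)
  record NonTreeEdge (G T : Rel n) : Set where
    constructor nte
    field
      src tgt : Fin n
      inG     : Adj G src tgt
      notT    : T src tgt ≡ false
  open NonTreeEdge public

  SameEdge : ∀ {G T} → NonTreeEdge G T → NonTreeEdge G T → Set
  SameEdge e f = (src e ≡ src f × tgt e ≡ tgt f) ⊎ (src e ≡ tgt f × tgt e ≡ src f)

  SharesTreeEdge : ∀ {G T} → NonTreeEdge G T → NonTreeEdge G T → Set
  SharesTreeEdge {T = T} e f =
    ∃[ u ] ∃[ v ] ∃[ p ] ∃[ q ]
      IsPath T (src e) (tgt e) p × IsPath T (src f) (tgt f) q × EdgeOn u v p × EdgeOn u v q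

  -- adjacency in the graph A_T (vertices = unordered non-tree edges)
  ATAdj : ∀ {G T} → NonTreeEdge G T → NonTreeEdge G T → Set
  ATAdj e f = ¬ SameEdge e f × SharesTreeEdge e f

  InF : ∀ {G T} → Rel n → NonTreeEdge G T → Set
  InF F e = Adj F (src e) (tgt e)

  IndependentInAT : (G T F : Rel n) → Set
  IndependentInAT G T F = ∀ (e f : NonTreeEdge G T) → InF F e → InF F f → ¬ ATAdj e f

  NonTreeSubset : (G T F : Rel n) → Set
  NonTreeSubset G T F = Symmetric F × (∀ u v → Adj F u v → Adj G u v × T u v ≡ false)

{-# OPTIONS --safe #-}
-- Let H = T ∪ F; a non-tree edge st closes its tree path into the fundamental cycle C(st).
-- If the tree paths of two edges of F share a tree edge, their fundamental cycles are two
-- different cycles through that edge. Conversely, assume independence and open a cycle C of H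
-- at an edge st ∈ F, leaving a path Q from t to s. Replacing the non-tree edges of Q by their
-- tree paths gives a tree walk from t to s, and in a tree such a walk uses every edge of the
-- tree path P from s to t. An edge of P reached through the tree path of another edge of F
-- would contradict independence, so P ⊆ Q, and a walk between the ends of the simple path Q
-- inside Q covers Q: hence C = C(st). As T is acyclic every cycle contains an edge of F, and two
-- cycles through a tree edge e have the same one, because e lies on the tree paths of both.
module Submission where

open import Defs
open import Data.Nat using (ℕ; _≤_; s≤s; z≤n)
open import Data.Fin using (Fin; _≟_)
open import Data.Bool using (true; false; _∨_)
open import Data.Bool.Properties using (∨-zeroʳ)
open import Data.List using (List; []; _∷_; _++_; [_]; head; last; length)
open import Data.List.Properties using (++-assoc; ++-identityʳ; length-++-comm)
open import Data.List.Relation.Unary.All using ([]; _∷_)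
import Data.List.Relation.Unary.All as All
import Data.List.Relation.Unary.All.Properties as All
open import Data.List.Relation.Unary.AllPairs using ([]; _∷_)
open import Data.List.Relation.Unary.Any using (here; there)
open import Data.List.Relation.Unary.Linked using (Linked; []; [-]; _∷_)
import Data.List.Relation.Unary.Linked as Linked
import Data.List.Relation.Unary.Linked.Properties as Linked
open import Data.List.Relation.Unary.Unique.Propositional using (Unique)
open import Data.List.Membership.Propositional using (_∈_; _∉_)
open import Data.List.Membership.Propositional.Properties using (∈-++⁺ʳ; ∈-∃++)
import Data.List.Membership.DecPropositional as DecMembership
open import Data.Maybe using (just)
open import Data.Maybe.Properties using (just-injective)
import Data.Maybe.Relation.Binary.Connected as Maybe
open import Data.Product as Product using (_×_; _,_; proj₁; proj₂; ∃; ∃₂)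
open import Data.Sum using (_⊎_; inj₁; inj₂)
import Data.Sum as Sum
open import Data.Sum.Function.Propositional using (_⊎-⇔_)
open import Data.Empty using (⊥; ⊥-elim)
open import Function using (id)
open import Function.Bundles using (_⇔_; mk⇔; Equivalence)
import Function.Properties.Equivalence as ⇔
open import Relation.Nullary using (¬_; Dec; yes; no)
open import Relation.Nullary.Decidable using (_×-dec_; _⊎-dec_)
open import Relation.Unary using (Pred; Decidable)
open import Relation.Binary using (DecidableEquality)
open import Relation.Binary.PropositionalEquality using (_≡_; _≢_; refl; sym; trans; cong; subst)

SamePair : {A : Set} → A → A → A → A → Set
SamePair a b s t = (a ≡ s × b ≡ t) ⊎ (a ≡ t × b ≡ s)

module _ {A : Set} {a b s t : A} where

  samePair-flip : SamePair a b s t ⇔ SamePair a b t s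
  samePair-flip = mk⇔ Sum.swap Sum.swap

  samePair-sym : SamePair a b s t → SamePair s t a b
  samePair-sym (inj₁ (refl , refl)) = inj₁ (refl , refl)
  samePair-sym (inj₂ (refl , refl)) = inj₂ (refl , refl)

Walk : {A : Set} → (A → A → Set) → A → A → List A → Set
Walk R a b xs = head xs ≡ just a × last xs ≡ just b × Linked R xs

path⇒walk : ∀ {n} {R : Rel n} {a b xs} → IsPath R a b xs → Walk (Adj R) a b xs
path⇒walk (h , l , lk , _) = h , l , lk

-- Concatenation of a walk ending in m with a walk starting in m, keeping one copy of m.
_⁀_ : {A : Set} → List A → List A → List A
xs ⁀ []       = xs
xs ⁀ (_ ∷ ys) = xs ++ ys

module _ {A : Set} where

  last-++-∷ : ∀ xs {y : A} {ys} → last (xs ++ y ∷ ys) ≡ last (y ∷ ys)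
  last-++-∷ []            = refl
  last-++-∷ (x ∷ [])      = refl
  last-++-∷ (x ∷ x′ ∷ xs) = last-++-∷ (x′ ∷ xs)

  last-∷ʳ : ∀ xs {x : A} → last (xs ++ [ x ]) ≡ just x
  last-∷ʳ xs = last-++-∷ xs

  last-glue : ∀ xs {m : A} {ys} → last xs ≡ just m → last (xs ++ ys) ≡ last (m ∷ ys)
  last-glue (x ∷ [])     refl = refl
  last-glue (x ∷ y ∷ xs) eq   = last-glue (y ∷ xs) eq

  last-∷-just : ∀ (x : A) xs → ∃ λ z → last (x ∷ xs) ≡ just z
  last-∷-just x []       = x , refl
  last-∷-just x (y ∷ xs) = last-∷-just y xs

  last-∈ : ∀ xs {z : A} → last xs ≡ just z → z ∈ xs
  last-∈ (x ∷ [])     refl = here refl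
  last-∈ (x ∷ y ∷ xs) eq   = there (last-∈ (y ∷ xs) eq)

  head-++-∷-∈ : ∀ xs {y z : A} {ys} → head (xs ++ y ∷ ys) ≡ just z → z ∈ xs ++ [ y ]
  head-++-∷-∈ []       refl = here refl
  head-++-∷-∈ (x ∷ xs) refl = here refl

  unique-rotate : ∀ {x : A} xs → Unique (x ∷ xs) → Unique (xs ++ [ x ])
  unique-rotate []       _                          = [] ∷ []
  unique-rotate (y ∷ ys) ((x≢y ∷ x≢ys) ∷ y≢ys ∷ u) =
    All.++⁺ y≢ys ((λ y≡x → x≢y (sym y≡x)) ∷ []) ∷ unique-rotate ys (x≢ys ∷ u)

  unique-++⁻ʳ : ∀ xs {ys : List A} → Unique (xs ++ ys) → Unique ys
  unique-++⁻ʳ []       u       = u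
  unique-++⁻ʳ (x ∷ xs) (_ ∷ u) = unique-++⁻ʳ xs u

  unique-split : ∀ xs {y z : A} {ys} → Unique (xs ++ y ∷ ys) → z ∈ xs ++ [ y ] → z ∉ ys
  unique-split []       (y≢ys ∷ _) (here refl) z∈ys = All.lookup y≢ys z∈ys refl
  unique-split (x ∷ xs) (x≢ ∷ _)   (here refl) z∈ys = All.lookup (All.++⁻ʳ xs x≢) (there z∈ys) refl
  unique-split (x ∷ xs) (_ ∷ u)    (there z∈)  z∈ys = unique-split xs u z∈ z∈ys

module _ {A : Set} {R : A → A → Set} where

  linked-++⁻ˡ : ∀ xs {ys} → Linked R (xs ++ ys) → Linked R xs
  linked-++⁻ˡ []           _        = []
  linked-++⁻ˡ (x ∷ [])     _        = [-]
  linked-++⁻ˡ (x ∷ y ∷ xs) (r ∷ lk) = r ∷ linked-++⁻ˡ (y ∷ xs) lk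

  linked-glue : ∀ {xs m ys} → Linked R xs → last xs ≡ just m → Linked R (m ∷ ys) → Linked R (xs ++ ys)
  linked-glue {ys = ys} lk eq lk′ =
    Linked.++⁺ lk (subst (λ z → Maybe.Connected R z (head ys)) (sym eq) (Linked.head′ lk′)) (Linked.tail lk′)

  linked-∷ʳ : ∀ {xs z w} → Linked R xs → last xs ≡ just z → R z w → Linked R (xs ++ [ w ])
  linked-∷ʳ lk eq r = linked-glue lk eq (r ∷ [-])

  walk-⁀ : ∀ {xs ys a m b} → Walk R a m xs → Walk R m b ys → Walk R a b (xs ⁀ ys)
  walk-⁀ {x ∷ xs} {m ∷ ys} (refl , lx , lkx) (refl , ly , lky) =
    refl , trans (last-glue (x ∷ xs) lx) ly , linked-glue lkx lx lky

  walk-split : ∀ xs {y ys a b} → Walk R a b (xs ++ y ∷ ys) → Walk R a y (xs ++ [ y ]) × Walk R y b (y ∷ ys)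
  walk-split []            (refl , l , lk)     = (refl , refl , [-]) , (refl , l , lk)
  walk-split (x ∷ [])      (refl , l , r ∷ lk) = (refl , refl , r ∷ [-]) , (refl , l , lk)
  walk-split (x ∷ x′ ∷ xs) (refl , l , r ∷ lk) with walk-split (x′ ∷ xs) (refl , l , lk)
  ... | (_ , l₁ , lk₁) , w₂ = (refl , l₁ , r ∷ lk₁) , w₂

module _ {A : Set} (_≟ᴬ_ : DecidableEquality A) {R : A → A → Set} where
  open DecMembership _≟ᴬ_ using (_∈?_)

  -- Loop erasure: cut out the closed subwalk between two visits of a repeated vertex.
  walk⇒path : ∀ xs {a b} → Walk R a b xs → ∃ λ ys → Walk R a b ys × Unique ys
  walk⇒path (x ∷ []) (refl , refl , _) = x ∷ [] , (refl , refl , [-]) , [] ∷ []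
  walk⇒path (x ∷ y ∷ xs) (refl , l , r ∷ lk) with walk⇒path (y ∷ xs) (refl , l , lk)
  ... | ys@(_ ∷ _) , w@(refl , ly , lky) , uy with x ∈? ys
  ...   | no x∉ys  = x ∷ ys , (refl , ly , r ∷ lky) , All.¬Any⇒All¬ ys x∉ys ∷ uy
  ...   | yes x∈ys with ∈-∃++ x∈ys
  ...     | pre , suf , eq =
    x ∷ suf , proj₂ (walk-split pre (subst (Walk R _ _) eq w)) , unique-++⁻ʳ pre (subst Unique eq uy)

module _ {n : ℕ} where
  open DecMembership (_≟_ {n}) using (_∈?_)

  samePair? : (a b s t : Fin n) → Dec (SamePair a b s t)
  samePair? a b s t = ((a ≟ s) ×-dec (b ≟ t)) ⊎-dec ((a ≟ t) ×-dec (b ≟ s))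

  edgeOn-sym : ∀ {u v : Fin n} {xs} → EdgeOn u v xs → EdgeOn v u xs
  edgeOn-sym here      = here'
  edgeOn-sym here'     = here
  edgeOn-sym (there e) = there (edgeOn-sym e)

  edgeOn-samePair : ∀ {a b u v : Fin n} {xs} → SamePair a b u v → EdgeOn u v xs → EdgeOn a b xs
  edgeOn-samePair (inj₁ (refl , refl)) e = e
  edgeOn-samePair (inj₂ (refl , refl)) e = edgeOn-sym e

  edgeOn-∷ : ∀ {a b x y : Fin n} {xs} → EdgeOn a b (x ∷ y ∷ xs) ⇔ (SamePair a b x y ⊎ EdgeOn a b (y ∷ xs))
  edgeOn-∷ = mk⇔ to from
    where
    to : ∀ {a b x y xs} → EdgeOn a b (x ∷ y ∷ xs) → SamePair a b x y ⊎ EdgeOn a b (y ∷ xs)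
    to here      = inj₁ (inj₁ (refl , refl))
    to here'     = inj₁ (inj₂ (refl , refl))
    to (there e) = inj₂ e
    from : ∀ {a b x y xs} → SamePair a b x y ⊎ EdgeOn a b (y ∷ xs) → EdgeOn a b (x ∷ y ∷ xs)
    from (inj₁ ab~xy) = edgeOn-samePair ab~xy here
    from (inj₂ e)     = there e

  edgeOn-∈ : ∀ {u v : Fin n} {xs} → EdgeOn u v xs → u ∈ xs × v ∈ xs
  edgeOn-∈ here      = here refl , there (here refl)
  edgeOn-∈ here'     = there (here refl) , here refl
  edgeOn-∈ (there e) = Product.map there there (edgeOn-∈ e)

  edgeOn-++⁺ˡ : ∀ {u v : Fin n} {xs} ys → EdgeOn u v xs → EdgeOn u v (xs ++ ys)
  edgeOn-++⁺ˡ ys here      = here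
  edgeOn-++⁺ˡ ys here'     = here'
  edgeOn-++⁺ˡ ys (there e) = there (edgeOn-++⁺ˡ ys e)

  edgeOn-glue⁺ : ∀ {u v m : Fin n} xs {ys} → last xs ≡ just m → EdgeOn u v (m ∷ ys) → EdgeOn u v (xs ++ ys)
  edgeOn-glue⁺ (x ∷ [])     refl e = e
  edgeOn-glue⁺ (x ∷ y ∷ xs) eq   e = there (edgeOn-glue⁺ (y ∷ xs) eq e)

  edgeOn-glue⁻ : ∀ {u v m : Fin n} xs {ys} → last xs ≡ just m → EdgeOn u v (xs ++ ys) →
                 EdgeOn u v xs ⊎ EdgeOn u v (m ∷ ys)
  edgeOn-glue⁻ (x ∷ [])     refl e         = inj₂ e
  edgeOn-glue⁻ (x ∷ y ∷ xs) eq   here      = inj₁ here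
  edgeOn-glue⁻ (x ∷ y ∷ xs) eq   here'     = inj₁ here'
  edgeOn-glue⁻ (x ∷ y ∷ xs) eq   (there e) = Sum.map₁ there (edgeOn-glue⁻ (y ∷ xs) eq e)

  edgeOn-⁀⁻ : ∀ {u v m : Fin n} xs {ys} → last xs ≡ just m → head ys ≡ just m → EdgeOn u v (xs ⁀ ys) →
              EdgeOn u v xs ⊎ EdgeOn u v ys
  edgeOn-⁀⁻ xs {_ ∷ _} lx refl = edgeOn-glue⁻ xs lx

  edgeOn-∷ʳ : ∀ {a b z w : Fin n} xs → last xs ≡ just z →
              EdgeOn a b (xs ++ [ w ]) ⇔ (EdgeOn a b xs ⊎ SamePair a b z w)
  edgeOn-∷ʳ xs lx = mk⇔ to from
    where
    to : ∀ {a b w} → EdgeOn a b (xs ++ [ w ]) → EdgeOn a b xs ⊎ SamePair a b _ w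
    to e with edgeOn-glue⁻ xs lx e
    ... | inj₁ e′    = inj₁ e′
    ... | inj₂ here  = inj₂ (inj₁ (refl , refl))
    ... | inj₂ here' = inj₂ (inj₂ (refl , refl))
    ... | inj₂ (there (there ()))
    from : ∀ {a b w} → EdgeOn a b xs ⊎ SamePair a b _ w → EdgeOn a b (xs ++ [ w ])
    from (inj₁ e)     = edgeOn-++⁺ˡ _ e
    from (inj₂ ab~zw) = edgeOn-glue⁺ xs lx (edgeOn-samePair ab~zw here)

  edgeOn-split : ∀ {u v : Fin n} {xs} → EdgeOn u v xs →
                 ∃₂ λ pre suf → ∃₂ λ s t → SamePair u v s t × xs ≡ pre ++ s ∷ t ∷ suf
  edgeOn-split here  = [] , _ , _ , _ , inj₁ (refl , refl) , refl
  edgeOn-split here' = [] , _ , _ , _ , inj₂ (refl , refl) , refl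
  edgeOn-split {xs = x ∷ _} (there e) with edgeOn-split e
  ... | pre , suf , s , t , uv~st , refl = x ∷ pre , suf , s , t , uv~st , refl

  edgeOn-split⁻ : ∀ {u v : Fin n} pre {s t suf} → EdgeOn u v (pre ++ s ∷ t ∷ suf) →
                  EdgeOn u v (pre ++ [ s ]) ⊎ SamePair u v s t ⊎ EdgeOn u v (t ∷ suf)
  edgeOn-split⁻ pre {s} {t} {suf} e =
    Sum.map₂ (Equivalence.to edgeOn-∷)
      (edgeOn-glue⁻ (pre ++ [ s ]) (last-∷ʳ pre) (subst (EdgeOn _ _) (sym (++-assoc pre [ s ] (t ∷ suf))) e))

  linked-edgeOn : ∀ {R : Fin n → Fin n → Set} {u v xs} → Linked R xs → EdgeOn u v xs → R u v ⊎ R v u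
  linked-edgeOn (r ∷ _)  here      = inj₁ r
  linked-edgeOn (r ∷ _)  here'     = inj₂ r
  linked-edgeOn (_ ∷ lk) (there e) = linked-edgeOn lk e

  linked-avoid : ∀ {R : Fin n → Fin n → Set} {s t xs} → Linked R xs →
                 EdgeOn s t xs ⊎ Linked (λ a b → R a b × ¬ SamePair a b s t) xs
  linked-avoid []  = inj₂ []
  linked-avoid [-] = inj₂ [-]
  linked-avoid {s = s} {t} {x ∷ y ∷ _} (r ∷ lk) with samePair? x y s t
  ... | yes xy~st = inj₁ (edgeOn-samePair (samePair-sym xy~st) here)
  ... | no ¬xy~st = Sum.map there ((r , ¬xy~st) ∷_) (linked-avoid lk)

  leaving-edge : ∀ {p} {P : Pred (Fin n) p} → Decidable P → ∀ x xs {b} → last (x ∷ xs) ≡ just b →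
                 P x → ¬ P b → ∃₂ λ u v → EdgeOn u v (x ∷ xs) × P u × ¬ P v
  leaving-edge P? x []       refl px ¬pb = ⊥-elim (¬pb px)
  leaving-edge P? x (y ∷ xs) lb   px ¬pb with P? y
  ... | no ¬py = x , y , here , px , ¬py
  ... | yes py with leaving-edge P? y xs lb py ¬pb
  ...   | u , v , e , pu , ¬pv = u , v , there e , pu , ¬pv

  path-ends-not-adjacent : ∀ xs {a b : Fin n} → Unique xs → 3 ≤ length xs → head xs ≡ just a → last xs ≡ just b →
                           ¬ EdgeOn a b xs
  path-ends-not-adjacent (x ∷ y ∷ [])     _                   (s≤s (s≤s ())) refl refl here
  path-ends-not-adjacent (x ∷ y ∷ z ∷ xs) (_ ∷ y≢ ∷ _)        _ refl lb here      =
    All.lookup y≢ (last-∈ (z ∷ xs) lb) refl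
  path-ends-not-adjacent (x ∷ x ∷ xs)     ((x≢x ∷ _) ∷ _)     _ refl _  here'     = x≢x refl
  path-ends-not-adjacent (x ∷ xs)         (x≢ ∷ _)            _ refl _  (there e) =
    All.lookup x≢ (proj₁ (edgeOn-∈ e)) refl

  -- To get from one side of an edge cd of Q to the other, P must cross cd.
  return-walk-covers-path : ∀ {Q P : List (Fin n)} {R s t a b} → Unique Q → head Q ≡ just t → last Q ≡ just s →
                            Walk R s t P → (∀ {x y} → EdgeOn x y P → EdgeOn x y Q) → EdgeOn a b Q → EdgeOn a b P
  return-walk-covers-path {P = p ∷ P} uQ hQ lQ (refl , lP , _) P⊆Q e with edgeOn-split e
  ... | pre , suf , c , d , ab~cd , refl
    with leaving-edge (_∈? d ∷ suf) p P lP (last-∈ (d ∷ suf) (trans (sym (last-++-∷ pre)) lQ))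
                      (unique-split pre uQ (head-++-∷-∈ pre hQ))
  ... | x , y , exy , x∈ , y∉ with edgeOn-split⁻ pre (P⊆Q exy)
  ...   | inj₁ e′              = ⊥-elim (unique-split pre uQ (proj₁ (edgeOn-∈ e′)) x∈)
  ...   | inj₂ (inj₁ xy~cd)    = edgeOn-samePair ab~cd (edgeOn-samePair (samePair-sym xy~cd) exy)
  ...   | inj₂ (inj₂ e′)       = ⊥-elim (y∉ (proj₂ (edgeOn-∈ e′)))

module _ {n : ℕ} {R : Rel n} (acyclic : Acyclic R) where

  no-bypass : ∀ {s t : Fin n} {W} → s ≢ t → Adj R s t → Walk (Adj R) t s W → EdgeOn s t W
  no-bypass {s} {t} {W} s≢t Rst (hW , lW , lkW) with linked-avoid lkW
  ... | inj₁ e    = e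
  ... | inj₂ lkW′ = ⊥-elim (closes (walk⇒path _≟_ W (hW , lW , lkW′)))
    where
    closes : (∃ λ ys → Walk (λ a b → Adj R a b × ¬ SamePair a b s t) t s ys × Unique ys) → ⊥
    closes (_ ∷ [] , (h , l , _) , _) = s≢t (trans (sym (just-injective l)) (just-injective h))
    closes (_ ∷ _ ∷ [] , (h , l , (_ , ¬st) ∷ [-]) , _) = ¬st (inj₂ (just-injective h , just-injective l))
    closes (ys@(_ ∷ _ ∷ _ ∷ _) , (refl , l , lk) , u) =
      acyclic ys (s≤s (s≤s (s≤s z≤n)) , u , linked-∷ʳ (Linked.map proj₁ lk) l Rst)

  -- The detour  t → b (along P), b → a (along W), a → s (along P)  must use the edge st,
  -- which P, being simple, does not use again.
  path-edge-on-return-walk : ∀ {a b u v : Fin n} {P W} → IsPath R a b P → Walk (Adj R) b a W →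
                             EdgeOn u v P → EdgeOn u v W
  path-edge-on-return-walk {W = W} (hP , lP , lkP , uP) wW e with edgeOn-split e
  ... | pre , suf , s , t , uv~st , refl with walk-split pre (hP , lP , lkP)
  ...   | wFront , (_ , lBack , Rst ∷ lkBack) = edgeOn-samePair uv~st (on-W (no-bypass s≢t Rst detour))
    where
    wBack : Walk (Adj R) t _ (t ∷ suf)
    wBack = refl , lBack , lkBack

    detour : Walk (Adj R) t s (((t ∷ suf) ⁀ W) ⁀ (pre ++ [ s ]))
    detour = walk-⁀ (walk-⁀ wBack wW) wFront

    s∉back : s ∉ t ∷ suf
    s∉back = unique-split pre uP (∈-++⁺ʳ pre (here refl))

    s≢t : s ≢ t
    s≢t s≡t = s∉back (here s≡t)

    on-W : EdgeOn s t (((t ∷ suf) ⁀ W) ⁀ (pre ++ [ s ])) → EdgeOn s t W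
    on-W e′ with edgeOn-⁀⁻ ((t ∷ suf) ⁀ W) (proj₁ (proj₂ (walk-⁀ wBack wW))) (proj₁ wFront) e′
    ... | inj₂ eFront = ⊥-elim (unique-split pre uP (proj₂ (edgeOn-∈ eFront)) (here refl))
    ... | inj₁ e″ with edgeOn-⁀⁻ (t ∷ suf) lBack (proj₁ wW) e″
    ...   | inj₁ eBack = ⊥-elim (s∉back (proj₁ (edgeOn-∈ eBack)))
    ...   | inj₂ eW    = eW

module _ {n : ℕ} where

  -- c opened at its edge {s,t}: the path from t to s that runs through all other edges of c.
  record OpenedAt (R : Rel n) (c : List (Fin n)) (s t : Fin n) : Set where
    field
      path   : List (Fin n)
      isPath : IsPath R t s path
      long   : 3 ≤ length path
      edges  : ∀ a b → InCycle a b c ⇔ (SamePair a b s t ⊎ EdgeOn a b path)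

  open OpenedAt public

module _ {n : ℕ} {R : Rel n} where

  cycle-rotate : ∀ {x y ys} → IsCycle R (x ∷ y ∷ ys) →
                 IsCycle R (y ∷ ys ++ [ x ]) × (∀ a b → InCycle a b (x ∷ y ∷ ys) ⇔ InCycle a b (y ∷ ys ++ [ x ]))
  cycle-rotate {x} {y} {ys} (len , u , r ∷ lk) =
    (subst (3 ≤_) (length-++-comm [ x ] (y ∷ ys)) len , unique-rotate (y ∷ ys) u , linked-∷ʳ lk lx r) ,
    λ a b → ⇔.trans edgeOn-∷ (⇔.trans (mk⇔ Sum.swap Sum.swap) (⇔.sym (edgeOn-∷ʳ (y ∷ ys ++ [ x ]) lx)))
    where
    lx : last (y ∷ ys ++ [ x ]) ≡ just x
    lx = last-∷ʳ (y ∷ ys)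

  cycle-opened-at-end : ∀ {t xs s} → IsCycle R (t ∷ xs) → last (t ∷ xs) ≡ just s → OpenedAt R (t ∷ xs) s t
  cycle-opened-at-end {t} {xs} (len , u , lk) ls = record
    { path   = t ∷ xs
    ; isPath = refl , ls , linked-++⁻ˡ (t ∷ xs) lk , u
    ; long   = len
    ; edges  = λ a b → ⇔.trans (edgeOn-∷ʳ (t ∷ xs) ls) (mk⇔ Sum.swap Sum.swap)
    }

  opened-resp : ∀ {c c′ s t} → (∀ a b → InCycle a b c ⇔ InCycle a b c′) → OpenedAt R c′ s t → OpenedAt R c s t
  opened-resp c~c′ op = record
    { path = path op ; isPath = isPath op ; long = long op ; edges = λ a b → ⇔.trans (c~c′ a b) (edges op a b) }

  -- Rotate c = xs ++ pre step by step until the edge found in xs closes the cycle.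
  cycle-open-inside : ∀ xs pre {c u v} → c ≡ xs ++ pre → EdgeOn u v xs → IsCycle R c →
                      ∃₂ λ s t → SamePair u v s t × OpenedAt R c s t
  cycle-open-inside (_ ∷ [])     _   _    (there ()) _
  cycle-open-inside (x ∷ y ∷ ys) pre refl e cyc with cycle-rotate cyc
  ... | cyc′ , c~c′ with e
  ...   | here     = x , y , inj₁ (refl , refl) , opened-resp c~c′ (cycle-opened-at-end cyc′ (last-∷ʳ (y ∷ ys ++ pre)))
  ...   | here'    = x , y , inj₂ (refl , refl) , opened-resp c~c′ (cycle-opened-at-end cyc′ (last-∷ʳ (y ∷ ys ++ pre)))
  ...   | there e′ with cycle-open-inside (y ∷ ys) (pre ++ [ x ]) (cong (y ∷_) (++-assoc ys pre [ x ])) e′ cyc′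
  ...     | s , t , uv~st , op = s , t , uv~st , opened-resp c~c′ op

  cycle-open : ∀ {c u v} → IsCycle R c → InCycle u v c → ∃₂ λ s t → SamePair u v s t × OpenedAt R c s t
  cycle-open {x ∷ xs} cyc e with last-∷-just x xs
  ... | z , lz with Equivalence.to (edgeOn-∷ʳ (x ∷ xs) lz) e
  ...   | inj₁ e′    = cycle-open-inside (x ∷ xs) [] (sym (++-identityʳ (x ∷ xs))) e′ cyc
  ...   | inj₂ uv~zx = z , x , uv~zx , cycle-opened-at-end cyc lz

module _ {n : ℕ} {R S : Rel n} where

  adj-∪ˡ : ∀ {u v} → Adj R u v → Adj (R ∪ S) u v
  adj-∪ˡ {u} {v} r = cong (_∨ S u v) r

  adj-∪ʳ : ∀ {u v} → Adj S u v → Adj (R ∪ S) u v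
  adj-∪ʳ {u} {v} s = trans (cong (R u v ∨_) s) (∨-zeroʳ (R u v))

  isPath-∪ˡ : ∀ {a b p} → IsPath R a b p → IsPath (R ∪ S) a b p
  isPath-∪ˡ (h , l , lk , u) = h , l , Linked.map adj-∪ˡ lk , u

  adj-∪⁻ : ∀ {u v} → Adj (R ∪ S) u v → Adj R u v ⊎ Adj S u v
  adj-∪⁻ {u} {v} rs with R u v
  ... | true  = inj₁ refl
  ... | false = inj₂ rs

  linked-∪⁻ : ∀ {xs} → Linked (Adj (R ∪ S)) xs → Linked (Adj R) xs ⊎ ∃₂ λ x y → Adj S x y × EdgeOn x y xs
  linked-∪⁻ []  = inj₁ []
  linked-∪⁻ [-] = inj₁ [-]
  linked-∪⁻ (rs ∷ lk) with adj-∪⁻ rs | linked-∪⁻ lk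
  ... | inj₂ s | _                    = inj₂ (_ , _ , s , here)
  ... | inj₁ r | inj₁ lkR             = inj₁ (r ∷ lkR)
  ... | inj₁ _ | inj₂ (x , y , s , e) = inj₂ (x , y , s , there e)

inCycle-samePair : ∀ {n} {a b u v : Fin n} c → SamePair a b u v → InCycle u v c → InCycle a b c
inCycle-samePair (_ ∷ _) ab~uv e = edgeOn-samePair ab~uv e

edgeOn⇒inCycle : ∀ {n} {u v : Fin n} c → EdgeOn u v c → InCycle u v c
edgeOn⇒inCycle (x ∷ _) e = edgeOn-++⁺ˡ [ x ] e

module _ {n : ℕ} {G T F : Rel n} (tree : Tree T) (nonTree : NonTreeSubset G T F) where

  private
    H : Rel n
    H = T ∪ F

    symmetricT : Symmetric T
    symmetricT = proj₁ tree

    acyclicT : Acyclic T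
    acyclicT = proj₂ (proj₂ tree)

    tree⇒H : ∀ {u v} → Adj T u v → Adj H u v
    tree⇒H = adj-∪ˡ {R = T} {S = F}

    nonTree⇒H : ∀ {u v} → Adj F u v → Adj H u v
    nonTree⇒H = adj-∪ʳ {R = T} {S = F}

    H⇒tree⊎nonTree : ∀ {u v} → Adj H u v → Adj T u v ⊎ Adj F u v
    H⇒tree⊎nonTree = adj-∪⁻ {R = T} {S = F}

  treePath : Fin n → Fin n → List (Fin n)
  treePath a b = proj₁ (proj₁ (proj₂ tree) a b)

  treePath-isPath : ∀ a b → IsPath T a b (treePath a b)
  treePath-isPath a b = proj₂ (proj₁ (proj₂ tree) a b)

  tree-edge : ∀ {a b u v P} → IsPath T a b P → EdgeOn u v P → Adj T u v
  tree-edge (_ , _ , lk , _) e = Sum.[ id , trans (symmetricT _ _) ] (linked-edgeOn lk e)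

  nonTree-edge : ∀ {s t} → Adj F s t → NonTreeEdge G T
  nonTree-edge {s} {t} f = nte s t (proj₁ (proj₂ nonTree s t f)) (proj₂ (proj₂ nonTree s t f))

  nonTree-sym : ∀ {s t} → Adj F s t → Adj F t s
  nonTree-sym {s} {t} f = trans (sym (proj₁ nonTree s t)) f

  tree-edge-not-nonTree : ∀ {u v x y} → Adj T u v → Adj F x y → ¬ SamePair u v x y
  tree-edge-not-nonTree Tuv f (inj₁ (refl , refl)) with () ← trans (sym Tuv) (notT (nonTree-edge f))
  tree-edge-not-nonTree Tuv f (inj₂ (refl , refl))
    with () ← trans (sym (trans (symmetricT _ _) Tuv)) (notT (nonTree-edge f))

  opposite-treePaths : ∀ {a b u v P P′} → IsPath T a b P → IsPath T b a P′ → EdgeOn u v P ⇔ EdgeOn u v P′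
  opposite-treePaths pP pP′ = mk⇔ (path-edge-on-return-walk acyclicT pP (path⇒walk pP′))
                                   (path-edge-on-return-walk acyclicT pP′ (path⇒walk pP))

  cycle-nonTree-edge : ∀ {c} → IsCycle H c → ∃₂ λ x y → Adj F x y × InCycle x y c
  cycle-nonTree-edge {x ∷ xs} (len , u , lk) with linked-∪⁻ lk
  ... | inj₁ lkT = ⊥-elim (acyclicT (x ∷ xs) (len , u , lkT))
  ... | inj₂ e   = e

  -- The edges of the tree walk obtained from Q by replacing each non-tree edge xy by treePath x y.
  ExpandedEdge : List (Fin n) → Fin n → Fin n → Set
  ExpandedEdge Q a b = EdgeOn a b Q ⊎ ∃₂ λ x y → Adj F x y × EdgeOn x y Q × EdgeOn a b (treePath x y)

  expandedEdge-∷ : ∀ {q Q a b} → ExpandedEdge Q a b → ExpandedEdge (q ∷ Q) a b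
  expandedEdge-∷ = Sum.map there (λ (x , y , f , e , e′) → x , y , f , there e , e′)

  expand : ∀ Q {a b} → Walk (Adj H) a b Q →
           ∃ λ W → Walk (Adj T) a b W × (∀ {u v} → EdgeOn u v W → ExpandedEdge Q u v)
  expand (q ∷ []) (refl , refl , _) = q ∷ [] , (refl , refl , [-]) , λ { (there ()) }
  expand (q ∷ q′ ∷ Q) (refl , l , h ∷ lk) with expand (q′ ∷ Q) (refl , l , lk) | H⇒tree⊎nonTree h
  ... | _ ∷ W , (refl , lW , lkW) , eW | inj₁ t =
    q ∷ q′ ∷ W , (refl , lW , t ∷ lkW) , λ { here → inj₁ here ; here' → inj₁ here' ; (there e) → expandedEdge-∷ (eW e) }
  ... | W , wW , eW | inj₂ f =
    treePath q q′ ⁀ W , walk-⁀ (path⇒walk (treePath-isPath q q′)) wW , viaTreePath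
    where
    viaTreePath : ∀ {u v} → EdgeOn u v (treePath q q′ ⁀ W) → ExpandedEdge (q ∷ q′ ∷ Q) u v
    viaTreePath e with edgeOn-⁀⁻ (treePath q q′) (proj₁ (proj₂ (treePath-isPath q q′))) (proj₁ wW) e
    ... | inj₁ eP = inj₂ (q , q′ , f , here , eP)
    ... | inj₂ eW′ = expandedEdge-∷ (eW eW′)

  module _ (independent : IndependentInAT G T F) where

    shared-tree-edge⇒samePair : ∀ {s t x y a b P P′} → Adj F s t → Adj F x y → IsPath T s t P → IsPath T x y P′ →
                              EdgeOn a b P → EdgeOn a b P′ → SamePair s t x y
    shared-tree-edge⇒samePair {s} {t} {x} {y} fst fxy pP pP′ e e′ with samePair? s t x y
    ... | yes same = same
    ... | no ¬same =
      ⊥-elim (independent (nonTree-edge fst) (nonTree-edge fxy) fst fxy (¬same , _ , _ , _ , _ , pP , pP′ , e , e′))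

    opened-cycle-is-treePath : ∀ {c s t P} → Adj F s t → (op : OpenedAt H c s t) → IsPath T s t P →
                               ∀ a b → EdgeOn a b (path op) ⇔ EdgeOn a b P
    opened-cycle-is-treePath {P = P} fst record { path = Q ; isPath = (hQ , lQ , lkQ , uQ) ; long = long₃ } pP a b =
      mk⇔ Q⊆P P⊆Q
      where
      P⊆Q : ∀ {a b} → EdgeOn a b P → EdgeOn a b Q
      P⊆Q e with expand Q (hQ , lQ , lkQ)
      ... | W , wW , fromQ with fromQ (path-edge-on-return-walk acyclicT pP wW e)
      ...   | inj₁ eQ = eQ
      ...   | inj₂ (x , y , fxy , exy , eP) =
        ⊥-elim (path-ends-not-adjacent Q uQ long₃ hQ lQ
                  (edgeOn-sym (edgeOn-samePair (shared-tree-edge⇒samePair fst fxy pP (treePath-isPath x y) e eP) exy)))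

      Q⊆P : ∀ {a b} → EdgeOn a b Q → EdgeOn a b P
      Q⊆P = return-walk-covers-path uQ hQ lQ (path⇒walk pP) P⊆Q

    cycle-edges : ∀ {c x y P} → IsCycle H c → Adj F x y → InCycle x y c → IsPath T x y P →
                  ∀ a b → InCycle a b c ⇔ (SamePair a b x y ⊎ EdgeOn a b P)
    cycle-edges cyc fxy e pP a b with cycle-open cyc e
    ... | s , t , inj₁ (refl , refl) , op =
      ⇔.trans (edges op a b) (⇔.refl ⊎-⇔ opened-cycle-is-treePath fxy op pP a b)
    ... | s , t , inj₂ (refl , refl) , op =
      ⇔.trans (edges op a b)
        (samePair-flip ⊎-⇔ ⇔.trans (opened-cycle-is-treePath (nonTree-sym fxy) op pP′ a b) (opposite-treePaths pP′ pP))
      where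
      pP′ : IsPath T s t (treePath s t)
      pP′ = treePath-isPath s t

    cycles-through-nonTree-edge : ∀ {x y c₁ c₂} → Adj F x y → IsCycle H c₁ → IsCycle H c₂ →
                                  InCycle x y c₁ → InCycle x y c₂ → ∀ a b → InCycle a b c₁ ⇔ InCycle a b c₂
    cycles-through-nonTree-edge {x} {y} fxy cyc₁ cyc₂ e₁ e₂ a b =
      ⇔.trans (cycle-edges cyc₁ fxy e₁ (treePath-isPath x y) a b)
              (⇔.sym (cycle-edges cyc₂ fxy e₂ (treePath-isPath x y) a b))

    independent⇒cactus : Cactus H
    independent⇒cactus = connected , cycles-agree
      where
      connected : Connected H
      connected a b = treePath a b , isPath-∪ˡ (treePath-isPath a b)

      cycles-agree : ∀ u v → Adj H u v → ∀ c₁ c₂ → IsCycle H c₁ → IsCycle H c₂ → InCycle u v c₁ → InCycle u v c₂ →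
                     ∀ a b → InCycle a b c₁ ⇔ InCycle a b c₂
      cycles-agree u v huv c₁ c₂ cyc₁ cyc₂ e₁ e₂ with H⇒tree⊎nonTree huv
      ... | inj₂ fuv = cycles-through-nonTree-edge fuv cyc₁ cyc₂ e₁ e₂
      ... | inj₁ tuv with cycle-nonTree-edge cyc₁ | cycle-nonTree-edge cyc₂
      ...   | x₁ , y₁ , f₁ , e₁′ | x₂ , y₂ , f₂ , e₂′ =
        cycles-through-nonTree-edge f₁ cyc₁ cyc₂ e₁′ (inCycle-samePair c₂ same e₂′)
        where
        on-treePath : ∀ {x y c} → Adj F x y → IsCycle H c → InCycle x y c → InCycle u v c → EdgeOn u v (treePath x y)
        on-treePath {x} {y} f cyc e euv with Equivalence.to (cycle-edges cyc f e (treePath-isPath x y) u v) euv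
        ... | inj₁ uv~xy = ⊥-elim (tree-edge-not-nonTree tuv f uv~xy)
        ... | inj₂ eP    = eP
        same : SamePair x₁ y₁ x₂ y₂
        same = shared-tree-edge⇒samePair f₁ f₂ (treePath-isPath x₁ y₁) (treePath-isPath x₂ y₂)
                 (on-treePath f₁ cyc₁ e₁′ e₁) (on-treePath f₂ cyc₂ e₂′ e₂)

  module _ (irreflexive : Irreflexive G) where

    fundamental-cycle : ∀ {s t p} → Adj F s t → IsPath T s t p → IsCycle H p × InCycle s t p
    fundamental-cycle {p = x ∷ []} f (refl , refl , _) with () ← trans (sym (inG (nonTree-edge f))) (irreflexive x)
    fundamental-cycle {p = x ∷ y ∷ []} f (refl , refl , t ∷ [-] , _) with () ← trans (sym t) (notT (nonTree-edge f))
    fundamental-cycle {p = p@(_ ∷ _ ∷ _ ∷ _)} f (refl , l , lk , u) =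
      (s≤s (s≤s (s≤s z≤n)) , u , linked-∷ʳ (Linked.map tree⇒H lk) l (nonTree⇒H (nonTree-sym f))) ,
      Equivalence.from (edgeOn-∷ʳ p l) (inj₂ (inj₂ (refl , refl)))

    nonTree-edge-of-fundamental-cycle : ∀ {s t x y q} → IsPath T s t q → T x y ≡ false → InCycle x y q → SamePair x y s t
    nonTree-edge-of-fundamental-cycle {q = q@(_ ∷ _)} pq@(refl , l , _) nt e with Equivalence.to (edgeOn-∷ʳ q l) e
    ... | inj₁ eq   with () ← trans (sym (tree-edge pq eq)) nt
    ... | inj₂ xy~ts = Equivalence.to samePair-flip xy~ts

    cactus⇒independent : Cactus H → IndependentInAT G T F
    cactus⇒independent (_ , cycles-agree) (nte s t _ nt) (nte s′ t′ _ _) fe ff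
                       (¬same , u , v , p , q , pp , pq , eu , ev) =
      ¬same (nonTree-edge-of-fundamental-cycle pq nt st∈q)
      where
      cycP : IsCycle H p × InCycle s t p
      cycP = fundamental-cycle fe pp
      cycQ : IsCycle H q × InCycle s′ t′ q
      cycQ = fundamental-cycle ff pq
      st∈q : InCycle s t q
      st∈q = Equivalence.to (cycles-agree u v (tree⇒H (tree-edge pp eu)) p q (proj₁ cycP) (proj₁ cycQ)
                                          (edgeOn⇒inCycle p eu) (edgeOn⇒inCycle q ev) s t)
                            (proj₂ cycP)

lemma1 : (n : ℕ) (G T F : Rel n) →
    SimpleGraph G → Connected G → SpanningTree G T → NonTreeSubset G T F →
    (Cactus (T ∪ F) ⇔ IndependentInAT G T F)
lemma1 n G T F (_ , irreflexive) _ (_ , tree) nonTree =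
  mk⇔ (cactus⇒independent tree nonTree irreflexive) (independent⇒cactus tree nonTree)
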